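{- For any formula $\varphi$ of propositional linear temporal logic, $\mathrm{LTL}\models\neg\Box(\varphi\leftrightarrow\neg\Box\varphi)$ and $\mathrm{LTL}\models\neg\Box(\varphi\leftrightarrow\Box\neg\varphi)$; i.e. the operators $x\mapsto\neg\Box x$ and $x\mapsto\Box\neg x$ have no fixed points in LTL.
   Context: Propositional linear temporal logic (LTL) over a set $\mathbf{V}$ of propositional constants, with formulas built from $\mathbf{V}$, $\mathbf{false}$, $\rightarrow$, the "next" operator $\bigcirc$ and the "always" operator $\Box$. A temporal (Kripke) structure is an infinite sequence $\mathcal{K}=(\eta_0,\eta_1,\dots)$ of valuations $\eta_i:\mathbf{V}\to\{\mathfrak{ff},\mathfrak{tt}\}$, with $\mathcal{K}_i(v)=\eta_i(v)$, classical clauses for the connectives, $\mathcal{K}_i(\bigcirc\varphi)=\mathcal{K}_{i+1}(\varphi)$, and $\mathcal{K}_i(\Box\varphi)=\mathfrak{tt}$ iff $\mathcal{K}_j(\varphi)=\mathfrak{tt}$ for all $j\ge i$. $\mathrm{LTL}\models\varphi$ means $\mathcal{K}_i(\varphi)=\mathfrak{tt}$ for every temporal structure $\mathcal{K}$ and every $i\in\mathbb{N}$; equivalently, $\neg\varphi$ is not satisfiable. -}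

module Defs where

open import Data.Nat using (ℕ; _≤_)
open import Data.Bool using (Bool; true)
open import Data.Empty using (⊥)
open import Relation.Binary.PropositionalEquality using (_≡_)

data Formula (V : Set) : Set where
  var   : V → Formula V
  false : Formula V
  _⇒_   : Formula V → Formula V → Formula V
  ○_    : Formula V → Formula V
  □_    : Formula V → Formula V

infixr 5 _⇒_
infixr 6 _⇔_
infixr 7 _∧_
infixr 9 ¬_
infixr 9 ○_ □_

¬_ : ∀ {V} → Formula V → Formula V
¬ φ = φ ⇒ false

_∧_ : ∀ {V} → Formula V → Formula V → Formula V
φ ∧ ψ = ¬ (φ ⇒ ¬ ψ)

_⇔_ : ∀ {V} → Formula V → Formula V → Formula V
φ ⇔ ψ = (φ ⇒ ψ) ∧ (ψ ⇒ φ)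

TemporalStructure : Set → Set
TemporalStructure V = ℕ → V → Bool

-- K_i(φ) = tt, rendered as a type.
Sat : ∀ {V} → TemporalStructure V → ℕ → Formula V → Set
Sat K i (var v)  = K i v ≡ true
Sat K i false    = ⊥
Sat K i (φ ⇒ ψ)  = Sat K i φ → Sat K i ψ
Sat K i (○ φ)    = Sat K (Data.Nat.suc i) φ
Sat K i (□ φ)    = ∀ j → i ≤ j → Sat K j φ

Valid : ∀ {V} → Formula V → Set
Valid {V} φ = (K : TemporalStructure V) (i : ℕ) → Sat K i φ

module Submission where

-- Since satisfaction is computed from Boolean valuations, every formula is
-- semantically stable under double negation (sat-stable), even though Sat
-- is read constructively as a type.  Hence a satisfied biconditional a ⇔ b
-- yields the two implications between a and b (⇔-to, ⇔-from).
--
-- Both fixed-point equations are then refuted pointwise on an arbitrary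
-- structure K, assuming the equation holds at every j ≥ i:
--  * φ ⇔ ¬□φ : □φ at some j ≥ i gives φ at j, hence ¬□φ at j, absurd;
--    so ¬□φ holds everywhere from i on, hence φ does, i.e. □φ at i, absurd.
--  * φ ⇔ □¬φ : φ at some j ≥ i gives □¬φ at j, hence ¬φ at j, absurd;
--    so □¬φ holds at i, hence φ at i, absurd.

open import Defs
open import Data.Product using (_×_; _,_)
open import Data.Nat using (_≤_)
open import Data.Nat.Properties using (≤-refl)
open import Data.Bool using (true; false)
open import Data.Empty using (⊥-elim)
open import Relation.Nullary using () renaming (¬_ to Not)
open import Relation.Binary.PropositionalEquality using (refl)

module _ {V : Set} (K : TemporalStructure V) where

  sat-stable : ∀ i (φ : Formula V) → Not (Not (Sat K i φ)) → Sat K i φ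
  sat-stable i (var v) ¬¬φ with K i v
  ... | true  = refl
  ... | false = ⊥-elim (¬¬φ (λ ()))
  sat-stable i false   ¬¬⊥ = ¬¬⊥ (λ b → b)
  sat-stable i (φ ⇒ ψ) ¬¬φ⇒ψ x =
    sat-stable i ψ (λ ¬ψ → ¬¬φ⇒ψ (λ φ⇒ψ → ¬ψ (φ⇒ψ x)))
  sat-stable i (○ φ)   ¬¬○φ = sat-stable _ φ ¬¬○φ
  sat-stable i (□ φ)   ¬¬□φ j i≤j =
    sat-stable j φ (λ ¬φ → ¬¬□φ (λ □φ → ¬φ (□φ j i≤j)))

  ⇔-to : ∀ i (a b : Formula V) → Sat K i (a ⇔ b) → Sat K i a → Sat K i b
  ⇔-to i a b a⇔b x = sat-stable i b (λ ¬y → a⇔b (λ a⇒b _ → ¬y (a⇒b x)))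

  ⇔-from : ∀ i (a b : Formula V) → Sat K i (a ⇔ b) → Sat K i b → Sat K i a
  ⇔-from i a b a⇔b y = sat-stable i a (λ ¬x → a⇔b (λ _ b⇒a → ¬x (b⇒a y)))

  no-fixpoint-¬□ : ∀ i (φ : Formula V) → Not (Sat K i (□ (φ ⇔ ¬ □ φ)))
  no-fixpoint-¬□ i φ fix = ¬□φ i ≤-refl □φ
    where
    ¬□φ : ∀ j → i ≤ j → Not (Sat K j (□ φ))
    ¬□φ j i≤j □φⱼ = ⇔-to j φ (¬ □ φ) (fix j i≤j) (□φⱼ j ≤-refl) □φⱼ

    □φ : Sat K i (□ φ)
    □φ j i≤j = ⇔-from j φ (¬ □ φ) (fix j i≤j) (¬□φ j i≤j)

  no-fixpoint-□¬ : ∀ i (φ : Formula V) → Not (Sat K i (□ (φ ⇔ □ ¬ φ)))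
  no-fixpoint-□¬ i φ fix = ¬φ i ≤-refl (⇔-from i φ (□ ¬ φ) (fix i ≤-refl) ¬φ)
    where
    ¬φ : ∀ j → i ≤ j → Not (Sat K j φ)
    ¬φ j i≤j φⱼ = ⇔-to j φ (□ ¬ φ) (fix j i≤j) φⱼ j ≤-refl φⱼ

proposition3p4 : {V : Set} (φ : Formula V) →
    Valid (¬ □ (φ ⇔ ¬ □ φ)) × Valid (¬ □ (φ ⇔ □ ¬ φ))
proposition3p4 φ = (λ K i → no-fixpoint-¬□ K i φ) , (λ K i → no-fixpoint-□¬ K i φ)
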